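{- Let $G$ be a connected bipartite graph with $n$ vertices and $m$ edges. Then $$Mo(G)\leq \sqrt{m^{2}n^{2}-4m\,Sz(G)}.$$
   Context: All graphs are finite, simple and undirected; $d(x,y)$ is the graph distance. For an edge $e=(u,v)$, $n_e(u)$ is the number of vertices $w$ with $d(w,u)<d(w,v)$. The Mostar index is $Mo(G)=\sum_{e=(u,v)\in E(G)}|n_e(u)-n_e(v)|$ and the Szeged index is $Sz(G)=\sum_{e=(u,v)\in E(G)}n_e(u)\,n_e(v)$. -}

module Defs where

open import Data.Bool using (Bool; true; false; _∧_; _∨_; if_then_else_)
open import Data.Nat using (ℕ; zero; suc; _+_; _*_; _∸_; _<ᵇ_)
open import Data.Fin using (Fin; toℕ)
open import Data.List using (List; []; _∷_; map; length; filter; allFin; concatMap)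
open import Data.Bool.ListAction using (any)
open import Data.Nat.ListAction using (sum)
open import Data.Product using (Σ; _×_; _,_; ∃)
open import Relation.Binary.PropositionalEquality using (_≡_; _≢_)
open import Relation.Nullary.Decidable using (does)
open import Relation.Nullary.Decidable using (T?)
open import Data.Bool using (T)

record Graph (n : ℕ) : Set where
  field
    adj       : Fin n → Fin n → Bool
    adj-sym   : ∀ u v → adj u v ≡ adj v u
    adj-irrefl : ∀ u → adj u u ≡ false
open Graph public

module _ {n : ℕ} (G : Graph n) where

  vertices : List (Fin n)
  vertices = allFin n

  sameVertex : Fin n → Fin n → Bool
  sameVertex u v = toℕ u Data.Nat.≡ᵇ toℕ v

  reach : ℕ → Fin n → Fin n → Bool
  reach zero    u w = sameVertex u w
  reach (suc k) u w = reach k u w ∨ any (λ v → reach k u v ∧ adj G v w) vertices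

  Connected : Set
  Connected = ∀ u v → ∃ λ k → reach k u v ≡ true

  Bipartite : Set
  Bipartite = Σ (Fin n → Bool) λ c → ∀ u v → adj G u v ≡ true → c u ≢ c v

  -- least k ≤ bound with reach k u w (returns bound if none); for a
  -- connected graph on n vertices the distance is < n, so bound n suffices.
  private
    search : ℕ → ℕ → Fin n → Fin n → ℕ
    search k zero     u w = k
    search k (suc b)  u w = if reach k u w then k else search (suc k) b u w

  dist : Fin n → Fin n → ℕ
  dist u w = search 0 n u w

  edges : List (Fin n × Fin n)
  edges = concatMap (λ u → map (λ v → u , v)
            (filter (λ v → T? ((toℕ u <ᵇ toℕ v) ∧ adj G u v)) vertices)) vertices

  numEdges : ℕ
  numEdges = length edges

  nClose : Fin n → Fin n → ℕ
  nClose u v = length (filter (λ w → T? (dist w u <ᵇ dist w v)) vertices)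

  absDiff : ℕ → ℕ → ℕ
  absDiff a b = (a ∸ b) + (b ∸ a)

  mostar : ℕ
  mostar = sum (map (λ { (u , v) → absDiff (nClose u v) (nClose v u) }) edges)

  szeged : ℕ
  szeged = sum (map (λ { (u , v) → nClose u v * nClose v u }) edges)

{-# OPTIONS --safe #-}
-- For an edge e = uv write a = n_e(u), b = n_e(v). The vertices closer to u
-- and those closer to v are disjoint, so a + b ≤ n, and hence
-- |a − b|² + 4ab = (a + b)² ≤ n². Summing over the m edges gives
-- Σ|a − b|² + 4·Sz ≤ m·n², and Cauchy–Schwarz, Mo² ≤ m·Σ|a − b|², turns this
-- into Mo² + 4·m·Sz ≤ m²·n².
module Submission where

open import Defs
open import Data.Nat using (ℕ; suc; _+_; _*_; _≤_; _<ᵇ_; z≤n; s≤s; ∣_-_∣)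
open import Data.Nat.Properties
open import Algebra.Properties.CommutativeSemigroup +-commutativeSemigroup
  using () renaming (interchange to +-interchange)
open import Data.Nat.Tactic.RingSolver using (solve; solve-∀)
open import Data.Nat.ListAction using (sum)
open import Data.Bool using (T)
open import Data.Fin using (Fin)
open import Data.List using ([]; _∷_; map; length; filter; allFin)
open import Data.List.Properties using (length-tabulate)
open import Data.Product using (_×_; _,_)
open import Data.Sum using (inj₁; inj₂)
open import Level using (Level)
open import Relation.Nullary using (¬_; Dec; yes; no; contradiction)
open import Relation.Nullary.Decidable using (T?)
open import Relation.Unary using (Pred; Decidable)
open import Relation.Binary.PropositionalEquality

∣m-n∣²+2mn≡m²+n² : ∀ m n → ∣ m - n ∣ * ∣ m - n ∣ + 2 * (m * n) ≡ m * m + n * n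
∣m-n∣²+2mn≡m²+n² m n with ≤-total m n
... | inj₁ m≤n with k , refl ← m≤n⇒∃[o]m+o≡n m≤n
  rewrite ∣m-m+n∣≡n m k = solve (m ∷ k ∷ [])
... | inj₂ n≤m with k , refl ← m≤n⇒∃[o]m+o≡n n≤m
  rewrite ∣-∣-comm (n + k) n | ∣m-m+n∣≡n n k = solve (n ∷ k ∷ [])

2mn≤m²+n² : ∀ m n → 2 * (m * n) ≤ m * m + n * n
2mn≤m²+n² m n =
  subst (2 * (m * n) ≤_) (∣m-n∣²+2mn≡m²+n² m n) (m≤n+m _ (∣ m - n ∣ * ∣ m - n ∣))

∣m-n∣²+4mn≡[m+n]² : ∀ m n → ∣ m - n ∣ * ∣ m - n ∣ + 4 * (m * n) ≡ (m + n) * (m + n)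
∣m-n∣²+4mn≡[m+n]² m n = begin
  ∣ m - n ∣ * ∣ m - n ∣ + 4 * (m * n)          ≡⟨ d+4x≡d+2x+2x (∣ m - n ∣ * ∣ m - n ∣) (m * n) ⟩
  ∣ m - n ∣ * ∣ m - n ∣ + 2 * (m * n) + 2 * (m * n) ≡⟨ cong (_+ 2 * (m * n)) (∣m-n∣²+2mn≡m²+n² m n) ⟩
  m * m + n * n + 2 * (m * n)                  ≡⟨ solve (m ∷ n ∷ []) ⟩
  (m + n) * (m + n)                            ∎
  where
    open ≡-Reasoning
    d+4x≡d+2x+2x : ∀ d x → d + 4 * x ≡ d + 2 * x + 2 * x
    d+4x≡d+2x+2x = solve-∀

absDiff≡∣-∣ : ∀ {n} (G : Graph n) a b → absDiff G a b ≡ ∣ a - b ∣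
absDiff≡∣-∣ G a b with ≤-total a b
... | inj₁ a≤b rewrite m≤n⇒m∸n≡0 a≤b | m≤n⇒∣m-n∣≡n∸m a≤b = refl
... | inj₂ b≤a rewrite m≤n⇒m∸n≡0 b≤a | m≤n⇒∣n-m∣≡n∸m b≤a = +-identityʳ _

module _ {a p q : Level} {A : Set a} {P : Pred A p} {Q : Pred A q}
         (P? : Decidable P) (Q? : Decidable Q) where

  length-filter-disjoint : (∀ {x} → P x → ¬ Q x) → ∀ xs →
    length (filter P? xs) + length (filter Q? xs) ≤ length xs
  length-filter-disjoint disjoint [] = z≤n
  length-filter-disjoint disjoint (x ∷ xs)
    with ih ← length-filter-disjoint disjoint xs | P? x | Q? x
  ... | yes px | yes qx = contradiction qx (disjoint px)
  ... | yes _  | no _   = s≤s ih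
  ... | no _   | yes _  = subst (_≤ suc (length xs)) (sym (+-suc _ _)) (s≤s ih)
  ... | no _   | no _   = m≤n⇒m≤1+n ih

nClose+nClose≤order : ∀ {n} (G : Graph n) u v → nClose G u v + nClose G v u ≤ n
nClose+nClose≤order {n} G u v =
  subst (nClose G u v + nClose G v u ≤_) (length-tabulate {n = n} (λ i → i))
    (length-filter-disjoint closer-to-u? closer-to-v? <ᵇ-asym (allFin n))
  where
    closer-to-u? : ∀ w → Dec (T (dist G w u <ᵇ dist G w v))
    closer-to-u? = λ w → T? (dist G w u <ᵇ dist G w v)
    closer-to-v? : ∀ w → Dec (T (dist G w v <ᵇ dist G w u))
    closer-to-v? = λ w → T? (dist G w v <ᵇ dist G w u)
    <ᵇ-asym : ∀ {w} → T (dist G w u <ᵇ dist G w v) → ¬ T (dist G w v <ᵇ dist G w u)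
    <ᵇ-asym {w} uv vu = <-asym (<ᵇ⇒< (dist G w u) _ uv) (<ᵇ⇒< (dist G w v) _ vu)

module _ {a : Level} {A : Set a} where

  2c*sum≤length*c²+sum-sq : ∀ (f : A → ℕ) c xs →
    2 * (c * sum (map f xs)) ≤ length xs * (c * c) + sum (map (λ x → f x * f x) xs)
  2c*sum≤length*c²+sum-sq f c [] rewrite *-zeroʳ c = z≤n
  2c*sum≤length*c²+sum-sq f c (x ∷ xs) = begin
    2 * (c * (f x + S))                  ≡⟨ expand c (f x) S ⟩
    2 * (c * f x) + 2 * (c * S)          ≤⟨ +-mono-≤ (2mn≤m²+n² c (f x)) (2c*sum≤length*c²+sum-sq f c xs) ⟩
    (c * c + f x * f x) + (L * (c * c) + Q) ≡⟨ regroup c (f x) L Q ⟩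
    (1 + L) * (c * c) + (f x * f x + Q)  ∎
    where
      open ≤-Reasoning
      S L Q : ℕ
      S = sum (map f xs)
      L = length xs
      Q = sum (map (λ x → f x * f x) xs)
      expand : ∀ c y s → 2 * (c * (y + s)) ≡ 2 * (c * y) + 2 * (c * s)
      expand = solve-∀
      regroup : ∀ c y l q → (c * c + y * y) + (l * (c * c) + q) ≡ (1 + l) * (c * c) + (y * y + q)
      regroup = solve-∀

  sum²≤length*sum-sq : ∀ (f : A → ℕ) xs →
    sum (map f xs) * sum (map f xs) ≤ length xs * sum (map (λ x → f x * f x) xs)
  sum²≤length*sum-sq f [] = z≤n
  sum²≤length*sum-sq f (x ∷ xs) = begin
    (f x + S) * (f x + S)                         ≡⟨ expand (f x) S ⟩
    f x * f x + 2 * (f x * S) + S * S             ≤⟨ +-mono-≤ (+-monoʳ-≤ (f x * f x) (2c*sum≤length*c²+sum-sq f (f x) xs))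
                                                                 (sum²≤length*sum-sq f xs) ⟩
    f x * f x + (L * (f x * f x) + Q) + L * Q     ≡⟨ regroup (f x) L Q ⟩
    (1 + L) * (f x * f x + Q)                     ∎
    where
      open ≤-Reasoning
      S L Q : ℕ
      S = sum (map f xs)
      L = length xs
      Q = sum (map (λ x → f x * f x) xs)
      expand : ∀ y s → (y + s) * (y + s) ≡ y * y + 2 * (y * s) + s * s
      expand = solve-∀
      regroup : ∀ y l q → y * y + (l * (y * y) + q) + l * q ≡ (1 + l) * (y * y + q)
      regroup = solve-∀

  sum-map-+ : ∀ (f g : A → ℕ) xs → sum (map (λ x → f x + g x) xs) ≡ sum (map f xs) + sum (map g xs)
  sum-map-+ f g [] = refl
  sum-map-+ f g (x ∷ xs) rewrite sum-map-+ f g xs =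
    +-interchange (f x) (g x) (sum (map f xs)) (sum (map g xs))

  sum-map-*ˡ : ∀ c (f : A → ℕ) xs → sum (map (λ x → c * f x) xs) ≡ c * sum (map f xs)
  sum-map-*ˡ c f [] = sym (*-zeroʳ c)
  sum-map-*ˡ c f (x ∷ xs) rewrite sum-map-*ˡ c f xs = sym (*-distribˡ-+ c (f x) _)

  sum-map-≤ : ∀ (f : A → ℕ) N → (∀ x → f x ≤ N) → ∀ xs → sum (map f xs) ≤ length xs * N
  sum-map-≤ f N f≤N [] = z≤n
  sum-map-≤ f N f≤N (x ∷ xs) = +-mono-≤ (f≤N x) (sum-map-≤ f N f≤N xs)

  sum²+4*length*sum≤length²*bound : ∀ (f g : A → ℕ) N → (∀ x → f x * f x + 4 * g x ≤ N) → ∀ xs →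
    sum (map f xs) * sum (map f xs) + 4 * length xs * sum (map g xs) ≤ length xs * length xs * N
  sum²+4*length*sum≤length²*bound f g N bound xs = begin
    S * S + 4 * L * R                               ≤⟨ +-monoˡ-≤ (4 * L * R) (sum²≤length*sum-sq f xs) ⟩
    L * Q + 4 * L * R                               ≡⟨ factor L Q R ⟩
    L * (Q + 4 * R)                                 ≡⟨ cong (L *_) (sym sum-of-bounded-terms) ⟩
    L * sum (map (λ x → f x * f x + 4 * g x) xs)    ≤⟨ *-monoʳ-≤ L (sum-map-≤ _ N bound xs) ⟩
    L * (L * N)                                     ≡⟨ *-assoc L L N ⟨
    L * L * N                                       ∎
    where
      open ≤-Reasoning
      S L Q R : ℕ
      S = sum (map f xs)
      L = length xs
      Q = sum (map (λ x → f x * f x) xs)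
      R = sum (map g xs)
      factor : ∀ l q t → l * q + 4 * l * t ≡ l * (q + 4 * t)
      factor = solve-∀
      sum-of-bounded-terms : sum (map (λ x → f x * f x + 4 * g x) xs) ≡ Q + 4 * R
      sum-of-bounded-terms =
        trans (sum-map-+ (λ x → f x * f x) (λ x → 4 * g x) xs) (cong (Q +_) (sum-map-*ˡ 4 g xs))

absDiff²+4*nClose*nClose≤order² : ∀ {n} (G : Graph n) u v →
  let a = nClose G u v; b = nClose G v u in
  absDiff G a b * absDiff G a b + 4 * (a * b) ≤ n * n
absDiff²+4*nClose*nClose≤order² {n} G u v = begin
  absDiff G a b * absDiff G a b + 4 * (a * b)  ≡⟨ cong (λ d → d * d + 4 * (a * b)) (absDiff≡∣-∣ G a b) ⟩
  ∣ a - b ∣ * ∣ a - b ∣ + 4 * (a * b)          ≡⟨ ∣m-n∣²+4mn≡[m+n]² a b ⟩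
  (a + b) * (a + b)                            ≤⟨ *-mono-≤ a+b≤n a+b≤n ⟩
  n * n                                        ∎
  where
    open ≤-Reasoning
    a b : ℕ
    a = nClose G u v
    b = nClose G v u
    a+b≤n : a + b ≤ n
    a+b≤n = nClose+nClose≤order G u v

-- The bound n_e(u) + n_e(v) ≤ n holds in every graph.
proposition3p8 : (n : ℕ) (G : Graph n) → Connected G → Bipartite G →
    mostar G * mostar G + 4 * numEdges G * szeged G ≤ numEdges G * numEdges G * (n * n)
proposition3p8 n G _ _ =
  sum²+4*length*sum≤length²*bound mostar-term szeged-term (n * n)
    (λ { (u , v) → absDiff²+4*nClose*nClose≤order² G u v }) (edges G)
  where
    mostar-term szeged-term : Fin n × Fin n → ℕ
    mostar-term (u , v) = absDiff G (nClose G u v) (nClose G v u)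
    szeged-term (u , v) = nClose G u v * nClose G v u
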